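{- For every even $q\ge2$ and every $\ell,n\ge1$, in the set $A_q^n((q-1)0^\ell)$ listed in $\prec$ order, any two consecutive words differ in exactly one position, and the two symbols in this position differ by $1$ or $-1$.
   Context: $A_q=\{0,1,\dots,q-1\}$; $A_q^n$ is the set of length-$n$ words over $A_q$; $(q-1)0^\ell$ is the symbol $q-1$ followed by $\ell$ zeros; $A_q^n(\mathbf f)$ is the set of words of $A_q^n$ not containing $\mathbf f$ as a factor (contiguous subword). For distinct words $\mathbf s,\mathbf t$ of equal length, with $k$ the leftmost differing position and $u=\sum_{i<k}s_i$, $\mathbf s\prec\mathbf t$ iff ($u$ even and $s_k<t_k$) or ($u$ odd and $s_k>t_k$). -}

module Defs where

open import Data.Nat using (ℕ; zero; suc; _+_; _∸_; _<_; _%_)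
open import Data.List using (List; []; _∷_; _++_; replicate)
open import Data.Vec using (Vec; toList)
open import Data.Vec.Relation.Unary.All using (All)
open import Data.Product using (_×_; ∃₂)
open import Data.Sum using (_⊎_)
open import Data.Empty using (⊥)
open import Relation.Binary.PropositionalEquality using (_≡_; _≢_)
open import Relation.Nullary using (¬_)

-- words of length n over ℕ (alphabet A_q enforced separately by All (_< q))
Word : ℕ → Set
Word n = Vec ℕ n

Factor : List ℕ → List ℕ → Set
Factor f w = ∃₂ λ u v → w ≡ u ++ f ++ v

forb : ℕ → ℕ → List ℕ
forb q ℓ = (q ∸ 1) ∷ replicate ℓ 0

InAvoid : (q ℓ : ℕ) {n : ℕ} → Word n → Set
InAvoid q ℓ w = All (_< q) w × ¬ Factor (forb q ℓ) (toList w)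

-- PrecFrom u s t : s ≺ t where u is the sum of the already-scanned common prefix.
-- At the leftmost differing position k with prefix sum u:
-- (u even and s_k < t_k) or (u odd and s_k > t_k).
PrecFrom : ℕ → List ℕ → List ℕ → Set
PrecFrom u [] [] = ⊥
PrecFrom u [] (_ ∷ _) = ⊥
PrecFrom u (_ ∷ _) [] = ⊥
PrecFrom u (a ∷ s) (b ∷ t) =
  (a ≡ b × PrecFrom (u + a) s t)
  ⊎ (a ≢ b × ((u % 2 ≡ 0 × a < b) ⊎ (u % 2 ≡ 1 × b < a)))

_≺_ : {n : ℕ} → Word n → Word n → Set
s ≺ t = PrecFrom 0 (toList s) (toList t)

-- Let s ≺ t be consecutive admissible words, with common prefix p, prefix sum u and
-- first differing letters a, b.  Flipping the parity of u reverses the order, so we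
-- may assume u even and a < b.  Then:
--   * b = a + 1, for otherwise p (a+1) (q-1)^m would lie strictly between s and t;
--   * the tail of s is the ≺-maximal admissible continuation of p a, and the tail of t
--     is the ≺-maximal continuation of p (a+1) (for the same parity u + a).
-- A maximal continuation starts with q-1 if the parity is even and with 0 if it is odd;
-- in the odd case a is odd and, q being even, neither a nor a+1 is 0 or q-1.  After this
-- first letter the forbidden factor can no longer reach back into the prefix, so both
-- tails are maximal in one and the same set, and hence coincide.
module Submission where

open import Defs
open import Data.Nat using (ℕ; zero; suc; _≤_; _<_; _+_; _%_; z≤n; s≤s; _≟_)
open import Data.Nat.Properties
  using (0≢1+n; +-identityʳ; +-suc; ≤-refl; ≤-pred; <-trans; <-cmp; <⇒≢; <-irrefl; ≤∧≢⇒<; n≢0⇒n>0; m≤n⇒m<n∨m≡n)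
open import Data.Nat.DivMod using (%-remove-+ʳ)
open import Data.Nat.Divisibility using (_∣_)
open import Data.Fin using (Fin)
import Data.Fin as Fin
open import Data.Vec using (Vec; []; _∷_; lookup; toList)
import Data.Vec as Vec
open import Data.Vec.Relation.Unary.All using (All; []; _∷_)
open import Data.Vec.Relation.Unary.All.Properties using (toList⁺)
open import Data.List using (List; []; _∷_; _++_; replicate; reverse; _ʳ++_)
import Data.List.Relation.Unary.All as ListAll
open import Data.List.Relation.Unary.All.Properties using (++⁻ʳ)
open import Data.List.Properties using (∷-injective; ++-assoc; ʳ++-defn)
open import Data.Product using (_×_; ∃; _,_; proj₁; proj₂; map₂)
open import Data.Sum using (_⊎_; inj₁; inj₂; swap)
open import Data.Empty using (⊥-elim)
open import Function using (_∘_)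
open import Relation.Binary.PropositionalEquality
  using (_≡_; _≢_; refl; sym; cong; subst; module ≡-Reasoning)
open import Relation.Nullary using (¬_; yes; no)
open import Relation.Binary.Definitions using (tri<; tri≈; tri>)
open import Relation.Unary using (Pred; _≐_)

open ≡-Reasoning

parity : ∀ e → e % 2 ≡ 0 ⊎ e % 2 ≡ 1
parity zero = inj₁ refl
parity (suc zero) = inj₂ refl
parity (suc (suc e)) = parity e

odd-after-even : ∀ e → e % 2 ≡ 0 → suc e % 2 ≡ 1
odd-after-even zero _ = refl
odd-after-even (suc zero) ()
odd-after-even (suc (suc e)) = odd-after-even e

even-after-odd : ∀ e → e % 2 ≡ 1 → suc e % 2 ≡ 0
even-after-odd zero ()
even-after-odd (suc zero) _ = refl
even-after-odd (suc (suc e)) = even-after-odd e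

odd-before-even : ∀ e → suc e % 2 ≡ 0 → e % 2 ≡ 1
odd-before-even zero ()
odd-before-even (suc zero) _ = refl
odd-before-even (suc (suc e)) = odd-before-even e

even-before-odd : ∀ e → suc e % 2 ≡ 1 → e % 2 ≡ 0
even-before-odd zero _ = refl
even-before-odd (suc zero) ()
even-before-odd (suc (suc e)) = even-before-odd e

-- Raising the offset by one flips the parity of every prefix sum, hence reverses
-- the order; these two lemmas let us assume the first difference is increasing.
suc-offset-reverses : ∀ e xs ys → PrecFrom (suc e) xs ys → PrecFrom e ys xs
suc-offset-reverses e [] [] ()
suc-offset-reverses e [] (_ ∷ _) ()
suc-offset-reverses e (_ ∷ _) [] ()
suc-offset-reverses e (a ∷ xs) (.a ∷ ys) (inj₁ (refl , p)) = inj₁ (refl , suc-offset-reverses (e + a) xs ys p)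
suc-offset-reverses e (a ∷ xs) (b ∷ ys) (inj₂ (a≢b , inj₁ (even , a<b))) =
  inj₂ (a≢b ∘ sym , inj₂ (odd-before-even e even , a<b))
suc-offset-reverses e (a ∷ xs) (b ∷ ys) (inj₂ (a≢b , inj₂ (odd , b<a))) =
  inj₂ (a≢b ∘ sym , inj₁ (even-before-odd e odd , b<a))

reverse-to-suc-offset : ∀ e xs ys → PrecFrom e xs ys → PrecFrom (suc e) ys xs
reverse-to-suc-offset e [] [] ()
reverse-to-suc-offset e [] (_ ∷ _) ()
reverse-to-suc-offset e (_ ∷ _) [] ()
reverse-to-suc-offset e (a ∷ xs) (.a ∷ ys) (inj₁ (refl , p)) = inj₁ (refl , reverse-to-suc-offset (e + a) xs ys p)
reverse-to-suc-offset e (a ∷ xs) (b ∷ ys) (inj₂ (a≢b , inj₁ (even , a<b))) =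
  inj₂ (a≢b ∘ sym , inj₂ (odd-after-even e even , a<b))
reverse-to-suc-offset e (a ∷ xs) (b ∷ ys) (inj₂ (a≢b , inj₂ (odd , b<a))) =
  inj₂ (a≢b ∘ sym , inj₁ (even-after-odd e odd , b<a))

Prec : ∀ {m} → ℕ → Vec ℕ m → Vec ℕ m → Set
Prec e s t = PrecFrom e (toList s) (toList t)

trichotomy : ∀ {m} e (s t : Vec ℕ m) → s ≡ t ⊎ (Prec e s t ⊎ Prec e t s)
trichotomy e [] [] = inj₁ refl
trichotomy e (a ∷ s) (b ∷ t) with a ≟ b
... | yes refl with trichotomy (e + a) s t
...   | inj₁ refl = inj₁ refl
...   | inj₂ (inj₁ p) = inj₂ (inj₁ (inj₁ (refl , p)))
...   | inj₂ (inj₂ p) = inj₂ (inj₂ (inj₁ (refl , p)))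
trichotomy e (a ∷ s) (b ∷ t) | no a≢b with parity e | <-cmp a b
... | _ | tri≈ _ a≡b _ = ⊥-elim (a≢b a≡b)
... | inj₁ even | tri< a<b _ _ = inj₂ (inj₁ (inj₂ (a≢b , inj₁ (even , a<b))))
... | inj₁ even | tri> _ _ b<a = inj₂ (inj₂ (inj₂ (a≢b ∘ sym , inj₁ (even , b<a))))
... | inj₂ odd | tri< a<b _ _ = inj₂ (inj₂ (inj₂ (a≢b ∘ sym , inj₂ (odd , a<b))))
... | inj₂ odd | tri> _ _ b<a = inj₂ (inj₁ (inj₂ (a≢b , inj₂ (odd , b<a))))

Maximal : ∀ {m p} → ℕ → Pred (Vec ℕ m) p → Vec ℕ m → Set p
Maximal e P s = ∀ w → P w → ¬ Prec e s w

NoneBetween : ∀ {m p} → ℕ → Pred (Vec ℕ m) p → Vec ℕ m → Vec ℕ m → Set p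
NoneBetween e P s t = ∀ w → P w → Prec e s w → ¬ Prec e w t

unique-maximum : ∀ {m p} e {P : Pred (Vec ℕ m) p} {s t} →
  P s → P t → Maximal e P s → Maximal e P t → s ≡ t
unique-maximum e {s = s} {t} Ps Pt Ms Mt with trichotomy e s t
... | inj₁ s≡t = s≡t
... | inj₂ (inj₁ s≺t) = ⊥-elim (Ms t Pt s≺t)
... | inj₂ (inj₂ t≺s) = ⊥-elim (Mt s Ps t≺s)

maximal-tail : ∀ {m p} e x {P : Pred (Vec ℕ (suc m)) p} {s} →
  Maximal e P (x ∷ s) → Maximal (e + x) (λ w → P (x ∷ w)) s
maximal-tail e x M w Pxw s≺w = M (x ∷ w) Pxw (inj₁ (refl , s≺w))

Adjacent : ∀ {m} → Vec ℕ m → Vec ℕ m → Set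
Adjacent {m} s t = ∃ λ (i : Fin m) → (lookup s i ≡ suc (lookup t i) ⊎ lookup t i ≡ suc (lookup s i))
  × ((j : Fin m) → j ≢ i → lookup s j ≡ lookup t j)

adjacent-sym : ∀ {m} {s t : Vec ℕ m} → Adjacent s t → Adjacent t s
adjacent-sym (i , step , rest) = i , swap step , λ j j≢i → sym (rest j j≢i)

adjacent-cons : ∀ {m} a {s t : Vec ℕ m} → Adjacent s t → Adjacent (a ∷ s) (a ∷ t)
adjacent-cons a (i , step , rest) =
  Fin.suc i , step , λ { Fin.zero _ → refl ; (Fin.suc j) j≢i → rest j (j≢i ∘ cong Fin.suc) }

adjacent-head : ∀ {m} {a b} {s t : Vec ℕ m} → a ≡ suc b ⊎ b ≡ suc a → s ≡ t → Adjacent (a ∷ s) (b ∷ t)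
adjacent-head step refl =
  Fin.zero , step , λ { Fin.zero 0≢0 → ⊥-elim (0≢0 refl) ; (Fin.suc j) _ → refl }

-- Words avoiding the factor c 0^(k+1); for the theorem c = q-1 and k+1 = ℓ.
module Avoidance (c k : ℕ) where

  forbidden : List ℕ
  forbidden = c ∷ replicate (suc k) 0

  Av : List ℕ → Set
  Av L = ¬ Factor forbidden L

  avoid-prefix : ∀ X {Y} → Av (X ++ Y) → Av X
  avoid-prefix X {Y} av (u , v , refl) = av (u , v ++ Y , (begin
    (u ++ forbidden ++ v) ++ Y  ≡⟨ ++-assoc u (forbidden ++ v) Y ⟩
    u ++ (forbidden ++ v) ++ Y  ≡⟨ cong (u ++_) (++-assoc forbidden v Y) ⟩
    u ++ forbidden ++ v ++ Y    ∎))

  avoid-suffix : ∀ X {Y} → Av (X ++ Y) → Av Y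
  avoid-suffix X av (u , v , refl) = av (X ++ u , v , sym (++-assoc X u (forbidden ++ v)))

  avoid-cons : ∀ {a Y} → a ≢ c → Av Y → Av (a ∷ Y)
  avoid-cons a≢c av ([] , v , eq) = a≢c (proj₁ (∷-injective eq))
  avoid-cons a≢c av (_ ∷ u , v , eq) = av (u , v , proj₂ (∷-injective eq))

  avoid-nonzero : ∀ {L} → ListAll.All (_≢ 0) L → Av L
  avoid-nonzero all (u , v , refl) with ++⁻ʳ u all
  ... | _ ListAll.∷ 0≢0 ListAll.∷ _ = 0≢0 refl

  zeros-prefix : ∀ j X {x Y v} → x ≢ 0 → X ++ x ∷ Y ≡ replicate j 0 ++ v →
    ∃ λ v′ → X ≡ replicate j 0 ++ v′
  zeros-prefix zero X _ _ = X , refl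
  zeros-prefix (suc j) [] x≢0 eq = ⊥-elim (x≢0 (proj₁ (∷-injective eq)))
  zeros-prefix (suc j) (y ∷ X) x≢0 eq with ∷-injective eq
  ... | refl , eq′ = map₂ (cong (0 ∷_)) (zeros-prefix j X x≢0 eq′)

  -- Only the first letter of the pattern is nonzero, so an occurrence meeting a
  -- nonzero letter x starts at x: gluing at x creates no new occurrence.
  avoid-glue : ∀ X {x Y} → x ≢ 0 → Av X → Av (x ∷ Y) → Av (X ++ x ∷ Y)
  avoid-glue [] _ _ avY occ = avY occ
  avoid-glue (y ∷ X) x≢0 avX avY ([] , v , eq) with ∷-injective eq
  ... | refl , eq′ with zeros-prefix (suc k) X x≢0 eq′
  ...   | v′ , X≡ = avX ([] , v′ , cong (c ∷_) X≡)
  avoid-glue (y ∷ X) x≢0 avX avY (_ ∷ u , v , eq) =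
    avoid-glue X x≢0 (avoid-suffix (y ∷ []) avX) avY (u , v , proj₂ (∷-injective eq))

  context-split : ∀ R {w} → Av (R ʳ++ w) → Av (reverse R) × Av w
  context-split R av = avoid-prefix (reverse R) av′ , avoid-suffix (reverse R) av′
    where av′ = subst Av (ʳ++-defn R) av

  context-glue : ∀ R {x w} → x ≢ 0 → Av (reverse R) → Av (x ∷ w) → Av (R ʳ++ x ∷ w)
  context-glue R x≢0 avR avw = subst Av (sym (ʳ++-defn R)) (avoid-glue (reverse R) x≢0 avR avw)

-- The argument for the alphabet A_q with q = q₀ + 2 and forbidden factor (q-1)0^(ℓ₀+1).
-- A prefix is represented reversed (R), so that extending it by a letter is R ↦ a ∷ R.
module GrayCode (q₀ ℓ₀ : ℕ) where

  q top : ℕ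
  q = suc (suc q₀)
  top = suc q₀

  open Avoidance top ℓ₀

  Admissible : ∀ {m} → List ℕ → Vec ℕ m → Set
  Admissible R w = All (_< q) w × Av (R ʳ++ toList w)

  -- Words w such that x w avoids the pattern: the continuations of x once the
  -- earlier context no longer matters.
  Continues : ∀ {m} → ℕ → Vec ℕ m → Set
  Continues x w = All (_< q) w × Av (x ∷ toList w)

  -- The block (q-1)^m, the largest word for even offset.
  tops : ∀ m → Vec ℕ m
  tops m = Vec.replicate m top

  all-tops : ∀ {p} {P : Pred ℕ p} m → P top → All P (tops m)
  all-tops zero _ = []
  all-tops (suc m) Ptop = Ptop ∷ all-tops m Ptop

  tops-continue : ∀ x m → Continues x (tops m)
  tops-continue x m with x ≟ 0
  ... | yes refl = all-tops m ≤-refl , avoid-cons (λ ()) (avoid-nonzero (toList⁺ (all-tops m (λ ()))))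
  ... | no x≢0 = all-tops m ≤-refl , avoid-nonzero (x≢0 ListAll.∷ toList⁺ (all-tops m (λ ())))

  after-nonzero : ∀ {m x} R → x < q → x ≢ 0 → Av (reverse R) →
    (λ (w : Vec ℕ m) → Admissible R (x ∷ w)) ≐ Continues x
  after-nonzero R x<q x≢0 avR =
    (λ { (_ ∷ Aw , av) → Aw , proj₂ (context-split R av) }) ,
    (λ { (Aw , av) → x<q ∷ Aw , context-glue R x≢0 avR av })

  -- A letter c ∉ {0, q-1}: a pattern occurrence can neither start nor continue at c.
  Inner : ℕ → Set
  Inner c = c ≢ 0 × c ≢ top

  after-zero : ∀ {m c} R → Inner c → Av (reverse R) →
    (λ (w : Vec ℕ m) → Admissible (c ∷ R) (0 ∷ w)) ≐ Continues 0
  after-zero {c = c} R (c≢0 , c≢top) avR =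
    (λ { (_ ∷ Aw , av) → Aw , avoid-suffix (c ∷ []) (proj₂ (context-split R av)) }) ,
    (λ { (Aw , av) → s≤s z≤n ∷ Aw , context-glue R c≢0 avR (avoid-cons c≢top av) })

  maximal-head-even : ∀ {m} e R {x} {s : Vec ℕ m} → e % 2 ≡ 0 → Av (reverse R) → x < q →
    Maximal e (Admissible R) (x ∷ s) → x ≡ top
  maximal-head-even {m} e R even avR x<q M with _ ≟ top
  ... | yes x≡top = x≡top
  ... | no x≢top = ⊥-elim (M (top ∷ tops m)
          (proj₂ (after-nonzero R ≤-refl (λ ()) avR) (tops-continue top m))
          (inj₂ (x≢top , inj₁ (even , ≤∧≢⇒< (≤-pred x<q) x≢top))))

  maximal-head-odd : ∀ {m} e {c} R {x} {s : Vec ℕ m} → e % 2 ≡ 1 → Inner c → Av (reverse R) →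
    Maximal e (Admissible (c ∷ R)) (x ∷ s) → x ≡ 0
  maximal-head-odd {m} e R odd inner avR M with _ ≟ 0
  ... | yes x≡0 = x≡0
  ... | no x≢0 = ⊥-elim (M (0 ∷ tops m)
          (proj₂ (after-zero R inner avR) (tops-continue 0 m))
          (inj₂ (x≢0 , inj₂ (odd , n≢0⇒n>0 x≢0))))

  equal-tails : ∀ {m p₁ p₂} e x {P₁ : Pred (Vec ℕ (suc m)) p₁} {P₂ : Pred (Vec ℕ (suc m)) p₂} {s t} →
    (λ w → P₁ (x ∷ w)) ≐ Continues x → (λ w → P₂ (x ∷ w)) ≐ Continues x →
    P₁ (x ∷ s) → P₂ (x ∷ t) → Maximal e P₁ (x ∷ s) → Maximal e P₂ (x ∷ t) → s ≡ t
  equal-tails e x (to₁ , from₁) (to₂ , from₂) Ps Pt Ms Mt = unique-maximum (e + x) (to₁ Ps) (to₂ Pt)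
    (λ w C → maximal-tail e x Ms w (from₁ C)) (λ w C → maximal-tail e x Mt w (from₂ C))

  -- For even offset both maxima start with q-1, after which the prefix is forgotten.
  maximal-continuation-even : ∀ {m} e R₁ R₂ {x y} {s t : Vec ℕ m} → e % 2 ≡ 0 →
    Av (reverse R₁) → Av (reverse R₂) → Admissible R₁ (x ∷ s) → Admissible R₂ (y ∷ t) →
    Maximal e (Admissible R₁) (x ∷ s) → Maximal e (Admissible R₂) (y ∷ t) → x ∷ s ≡ y ∷ t
  maximal-continuation-even e R₁ R₂ even avR₁ avR₂ Ss@(x<q ∷ _ , _) St@(y<q ∷ _ , _) Ms Mt
    with maximal-head-even e R₁ even avR₁ x<q Ms | maximal-head-even e R₂ even avR₂ y<q Mt
  ... | refl | refl = cong (top ∷_) (equal-tails e top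
          (after-nonzero R₁ ≤-refl (λ ()) avR₁) (after-nonzero R₂ ≤-refl (λ ()) avR₂) Ss St Ms Mt)

  -- For odd offset after inner letters both maxima start with 0, after which the
  -- prefix is forgotten.
  maximal-continuation-odd : ∀ {m} e {c₁ c₂} R₁ R₂ {x y} {s t : Vec ℕ m} → e % 2 ≡ 1 →
    Inner c₁ → Inner c₂ → Av (reverse R₁) → Av (reverse R₂) →
    Admissible (c₁ ∷ R₁) (x ∷ s) → Admissible (c₂ ∷ R₂) (y ∷ t) →
    Maximal e (Admissible (c₁ ∷ R₁)) (x ∷ s) → Maximal e (Admissible (c₂ ∷ R₂)) (y ∷ t) → x ∷ s ≡ y ∷ t
  maximal-continuation-odd e R₁ R₂ odd inner₁ inner₂ avR₁ avR₂ Ss St Ms Mt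
    with maximal-head-odd e R₁ odd inner₁ avR₁ Ms | maximal-head-odd e R₂ odd inner₂ avR₂ Mt
  ... | refl | refl = cong (0 ∷_) (equal-tails e 0
          (after-zero R₁ inner₁ avR₁) (after-zero R₂ inner₂ avR₂) Ss St Ms Mt)

  maximal-continuation-unique : ∀ {m} e c₁ c₂ R₁ R₂ {s t : Vec ℕ m} →
    (e % 2 ≡ 1 → Inner c₁ × Inner c₂) →
    Admissible (c₁ ∷ R₁) s → Admissible (c₂ ∷ R₂) t →
    Maximal e (Admissible (c₁ ∷ R₁)) s → Maximal e (Admissible (c₂ ∷ R₂)) t → s ≡ t
  maximal-continuation-unique e c₁ c₂ R₁ R₂ {[]} {[]} _ _ _ _ _ = refl
  maximal-continuation-unique e c₁ c₂ R₁ R₂ {_ ∷ _} {_ ∷ _} inner Ss@(_ , av₁) St@(_ , av₂) Ms Mt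
    with parity e
  ... | inj₁ even = maximal-continuation-even e (c₁ ∷ R₁) (c₂ ∷ R₂) even
          (proj₁ (context-split (c₁ ∷ R₁) av₁)) (proj₁ (context-split (c₂ ∷ R₂) av₂)) Ss St Ms Mt
  ... | inj₂ odd = maximal-continuation-odd e R₁ R₂ odd (proj₁ (inner odd)) (proj₂ (inner odd))
          (proj₁ (context-split R₁ av₁)) (proj₁ (context-split R₂ av₂)) Ss St Ms Mt

  -- With even prefix sum e and odd e + a, the letter a is odd; as q is even, neither
  -- a nor a+1 equals 0 or q-1.
  odd-step-inner : 2 ∣ q → ∀ e {a} → e % 2 ≡ 0 → (e + a) % 2 ≡ 1 → suc a < q → Inner a × Inner (suc a)
  odd-step-inner q-even e {a} even odd sa<q = (a≢0 , a≢top) , ((λ ()) , sa≢top)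
    where
      a≢0 : a ≢ 0
      a≢0 refl = 0≢1+n (begin
        0              ≡⟨ sym even ⟩
        e % 2          ≡⟨ cong (_% 2) (sym (+-identityʳ e)) ⟩
        (e + 0) % 2    ≡⟨ odd ⟩
        1              ∎)
      a≢top : a ≢ top
      a≢top refl = <-irrefl refl sa<q
      sa≢top : suc a ≢ top
      sa≢top sa≡top = 0≢1+n (begin
        0                      ≡⟨ sym even ⟩
        e % 2                  ≡⟨ sym (%-remove-+ʳ e q-even) ⟩
        (e + q) % 2            ≡⟨ cong (λ n → (e + suc n) % 2) (sym sa≡top) ⟩
        (e + suc (suc a)) % 2  ≡⟨ cong (_% 2) (+-suc e (suc a)) ⟩
        suc (e + suc a) % 2    ≡⟨ cong (λ n → suc n % 2) (+-suc e a) ⟩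
        (e + a) % 2            ≡⟨ odd ⟩
        1                      ∎)

  -- An increasing first difference between consecutive words is a step by exactly one:
  -- otherwise (a+1)(q-1)^m lies strictly in between.
  step-is-one : ∀ {m} e R {a b} {s t : Vec ℕ m} → e % 2 ≡ 0 → a < b →
    Admissible R (a ∷ s) → Admissible R (b ∷ t) → NoneBetween e (Admissible R) (a ∷ s) (b ∷ t) → b ≡ suc a
  step-is-one {m} e R {a} even a<b (_ , avs) (b<q ∷ _ , _) none with m≤n⇒m<n∨m≡n a<b
  ... | inj₂ sa≡b = sym sa≡b
  ... | inj₁ sa<b = ⊥-elim (none (suc a ∷ tops m) between
          (inj₂ (<⇒≢ ≤-refl , inj₁ (even , ≤-refl))) (inj₂ (<⇒≢ sa<b , inj₁ (even , sa<b))))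
    where
      between : Admissible R (suc a ∷ tops m)
      between = proj₂ (after-nonzero R (<-trans sa<b b<q) (λ ()) (proj₁ (context-split R avs)))
                      (tops-continue (suc a) m)

  -- Consecutive words whose first difference is increasing (even prefix sum) are adjacent:
  -- the step is one, and both tails are maximal continuations, hence equal.
  first-difference : 2 ∣ q → ∀ {m} e R {a b} {s t : Vec ℕ m} → e % 2 ≡ 0 → a < b →
    Admissible R (a ∷ s) → Admissible R (b ∷ t) → NoneBetween e (Admissible R) (a ∷ s) (b ∷ t) →
    Adjacent (a ∷ s) (b ∷ t)
  first-difference q-even e R {a} {s = s} {t} even a<b Ss@(a<q ∷ As , avs) St@(b<q ∷ At , avt) none
    with step-is-one e R even a<b Ss St none
  ... | refl = adjacent-head (inj₂ refl)
          (maximal-continuation-unique (e + a) a (suc a) R R inner (As , avs) (At , avt) Ms Mt)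
    where
      inner : (e + a) % 2 ≡ 1 → Inner a × Inner (suc a)
      inner = λ odd → odd-step-inner q-even e even odd b<q
      a≺sa : ∀ {xs ys} → PrecFrom e (a ∷ xs) (suc a ∷ ys)
      a≺sa = inj₂ (<⇒≢ ≤-refl , inj₁ (even , ≤-refl))
      Ms : Maximal (e + a) (Admissible (a ∷ R)) s
      Ms w (Aw , avw) s≺w = none (a ∷ w) (a<q ∷ Aw , avw) (inj₁ (refl , s≺w)) a≺sa
      Mt : Maximal (e + a) (Admissible (suc a ∷ R)) t
      Mt w (Aw , avw) t≺w = none (suc a ∷ w) (b<q ∷ Aw , avw) a≺sa
        (inj₁ (refl , subst (λ e′ → PrecFrom e′ (toList w) (toList t)) (sym (+-suc e a))
                            (reverse-to-suc-offset (e + a) (toList t) (toList w) t≺w)))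

  -- Consecutive admissible continuations of a prefix are adjacent: strip the common
  -- prefix, then reduce a decreasing first difference to an increasing one.
  consecutive : 2 ∣ q → ∀ {m} e R (s t : Vec ℕ m) → Admissible R s → Admissible R t →
    Prec e s t → NoneBetween e (Admissible R) s t → Adjacent s t
  consecutive q-even e R [] [] _ _ () _
  consecutive q-even e R (a ∷ s) (.a ∷ t) (a<q ∷ As , avs) (_ ∷ At , avt) (inj₁ (refl , s≺t)) none =
    adjacent-cons a (consecutive q-even (e + a) (a ∷ R) s t (As , avs) (At , avt) s≺t
      (λ w (Aw , avw) s≺w w≺t → none (a ∷ w) (a<q ∷ Aw , avw) (inj₁ (refl , s≺w)) (inj₁ (refl , w≺t))))
  consecutive q-even e R (a ∷ s) (b ∷ t) Ss St (inj₂ (_ , inj₁ (even , a<b))) none =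
    first-difference q-even e R even a<b Ss St none
  consecutive q-even e R (a ∷ s) (b ∷ t) Ss St (inj₂ (_ , inj₂ (odd , b<a))) none =
    adjacent-sym {s = b ∷ t} {a ∷ s} (first-difference q-even (suc e) R (even-after-odd e odd) b<a St Ss
      (λ w Pw t≺w w≺s → none w Pw (suc-offset-reverses e _ _ w≺s) (suc-offset-reverses e _ _ t≺w)))

proposition14 : (q ℓ n : ℕ) → 2 ≤ q → 2 ∣ q → 1 ≤ ℓ → 1 ≤ n →
    (s t : Word n) → InAvoid q ℓ s → InAvoid q ℓ t → s ≺ t →
    (¬ ∃ λ (w : Word n) → InAvoid q ℓ w × s ≺ w × w ≺ t) →
    ∃ λ (i : Fin n) → (lookup s i ≡ suc (lookup t i) ⊎ lookup t i ≡ suc (lookup s i))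
    × ((j : Fin n) → j ≢ i → lookup s j ≡ lookup t j)
proposition14 (suc (suc q₀)) (suc ℓ₀) n (s≤s (s≤s z≤n)) q-even (s≤s z≤n) _ s t s-ok t-ok s≺t none =
  GrayCode.consecutive q₀ ℓ₀ q-even 0 [] s t s-ok t-ok s≺t
    (λ w w-ok s≺w w≺t → none (w , w-ok , s≺w , w≺t))
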